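{- Let $G$ be an abelian group, $r,\ell\in\mathbb N$, $d\in\mathbb N$, $b_1,\dots,b_q\in G$, and let $\mathcal A=(A_1,\dots,A_q)$ be a chromatic asymptotic $(r,\ell)$-approximate group in $G$. Define $A_i':=d\ast A_i+b_i=\{da+b_i:a\in A_i\}$ for $1\le i\le q$. Then $\mathcal A'=(A_1',\dots,A_q')$ is also a chromatic asymptotic $(r,\ell)$-approximate group.
   Context: $\mathbb N=\{1,2,\dots\}$, $\mathbb N_0=\{0,1,2,\dots\}$. Here $d\ast A=\{da:a\in A\}$ denotes the dilation. For subsets $X,Y$, $X+Y=\{x+y:x\in X,y\in Y\}$; for $h\in\mathbb N$, $hA$ is the $h$-fold sumset $A+\cdots+A$ and $0A=\{0\}$. For a tuple $\mathcal A$ and $\mathbf h=(h_1,\dots,h_q)\in\mathbb N_0^q$, $\mathbf h\cdot\mathcal A=h_1A_1+\cdots+h_qA_q$, $r\mathbf h=(rh_1,\dots,rh_q)$, and $\mathbf h\preceq\mathbf h'$ means $h_i\le h_i'$ for all $i$. $\mathcal A$ is a chromatic asymptotic $(r,\ell)$-approximate group if there is $\mathbf h_0$ such that for every $\mathbf h\succeq\mathbf h_0$ there is $X_{\mathbf h}\subseteq G$ with $|X_{\mathbf h}|\le\ell$ and $(r\mathbf h)\cdot\mathcal A\subseteq X_{\mathbf h}+\mathbf h\cdot\mathcal A$. -}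

module Defs where

open import Level using (Level; _⊔_; Lift)
open import Algebra.Bundles using (AbelianGroup)
open import Data.Nat using (ℕ; zero; suc; _≤_)
open import Data.Fin using (Fin) renaming (zero to fzero; suc to fsuc)
open import Data.Product using (Σ; _×_)
open import Data.List using (List; length)
open import Data.List.Relation.Unary.Any using (Any)

module _ {c ℓ : Level} (G : AbelianGroup c ℓ) where
  open AbelianGroup G

  -- subsets of G, as predicates on the carrier (membership tested up to ≈)
  Subset : Set (Level.suc (c ⊔ ℓ))
  Subset = Carrier → Set (c ⊔ ℓ)

  mul : ℕ → Carrier → Carrier
  mul zero    g = ε
  mul (suc n) g = g ∙ mul n g

  dilateShift : ℕ → Subset → Carrier → Subset
  dilateShift d A b x = Σ Carrier λ a → A a × (x ≈ mul d a ∙ b)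

  hFold : ℕ → Subset → Subset
  hFold zero    A x = Lift c (x ≈ ε)
  hFold (suc h) A x = Σ Carrier λ a → Σ Carrier λ y → A a × hFold h A y × (x ≈ a ∙ y)

  -- h · 𝒜 = h₁A₁ + ... + h_qA_q for a q-tuple 𝒜 and h ∈ ℕ₀^q
  tupleSum : (q : ℕ) → (Fin q → ℕ) → (Fin q → Subset) → Subset
  tupleSum zero    h 𝒜 x = Lift c (x ≈ ε)
  tupleSum (suc q) h 𝒜 x =
    Σ Carrier λ a → Σ Carrier λ y →
      hFold (h fzero) (𝒜 fzero) a × tupleSum q (λ i → h (fsuc i)) (λ i → 𝒜 (fsuc i)) y × (x ≈ a ∙ y)

  translates : List Carrier → Subset → Subset
  translates X S x = Any (λ t → Σ Carrier λ s → S s × (x ≈ t ∙ s)) X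

  _⊆_ : Subset → Subset → Set (c ⊔ ℓ)
  S ⊆ T = ∀ x → S x → T x

  ChromaticAsymptoticApproxGroup : (q : ℕ) → ℕ → ℕ → (Fin q → Subset) → Set (c ⊔ ℓ)
  ChromaticAsymptoticApproxGroup q r l 𝒜 =
    Σ (Fin q → ℕ) λ h₀ → ∀ (h : Fin q → ℕ) → (∀ i → h₀ i ≤ h i) →
      Σ (List Carrier) λ X → length X ≤ l ×
        (tupleSum q (λ i → r Data.Nat.* h i) 𝒜 ⊆ translates X (tupleSum q h 𝒜))

{-# OPTIONS --safe #-}
module Submission where

-- Since x ↦ d x is an endomorphism of the abelian group G, the sumsets of the dilated and shifted
-- tuple are affine images of those of the original one: h · 𝒜′ = d ∗ (h · 𝒜) + Σᵢ hᵢ bᵢ.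
-- Applying x ↦ d x + Σᵢ r hᵢ bᵢ to a covering (r h) · 𝒜 ⊆ X + h · 𝒜 therefore gives
-- (r h) · 𝒜′ ⊆ X′ + h · 𝒜′, where X′ = d ∗ X + (Σᵢ r hᵢ bᵢ − Σᵢ hᵢ bᵢ) has at most |X| elements.

open import Defs hiding (_⊆_)
import Defs
open import Level using (Level; _⊔_; Lift; lift)
open import Algebra.Bundles using (AbelianGroup)
open import Algebra.Morphism.Structures using (module MonoidMorphisms)
open import Data.Nat using (ℕ; NonZero; zero; suc; _*_; _≤_)
open import Data.Fin using (Fin) renaming (zero to fzero; suc to fsuc)
open import Data.Product using (Σ; _×_; _,_)
open import Data.List using (map)
import Data.List.Relation.Unary.Any as Any
open import Data.List.Relation.Unary.Any.Properties using (map⁺)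
open import Data.List.Properties using (length-map)
open import Relation.Binary.PropositionalEquality as ≡ using (_≡_)
import Algebra.Properties.AbelianGroup as AbelianGroupProperties
import Algebra.Properties.CommutativeMonoid.Mult as CommutativeMonoidMult
import Algebra.Properties.CommutativeSemigroup as CommutativeSemigroupProperties
import Relation.Binary.Reasoning.Setoid as SetoidReasoning

module _ {c ℓ : Level} (G : AbelianGroup c ℓ) where
  open AbelianGroup G
  open AbelianGroupProperties G using (//-rightDividesˡ)
  open CommutativeSemigroupProperties commutativeSemigroup using (interchange)
  open CommutativeMonoidMult commutativeMonoid using (×-congʳ; ×-distrib-+) renaming (_×_ to _·_)
  open MonoidMorphisms rawMonoid rawMonoid using (IsMonoidHomomorphism)
  open SetoidReasoning setoid

  infix 4 _⊆_
  infixl 6 _⊕_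

  _⊆_ : Subset G → Subset G → Set (c ⊔ ℓ)
  _⊆_ = Defs._⊆_ G

  ⊆-refl : ∀ {S} → S ⊆ S
  ⊆-refl x x∈S = x∈S

  ⊆-trans : ∀ {S T U} → S ⊆ T → T ⊆ U → S ⊆ U
  ⊆-trans S⊆T T⊆U x x∈S = T⊆U x (S⊆T x x∈S)

  -- hFold G (suc n) A and tupleSum G (suc q) h 𝒜 unfold to sums _⊕_, and their zero cases to ⁅ε⁆.
  _⊕_ : Subset G → Subset G → Subset G
  (A ⊕ B) x = Σ Carrier λ a → Σ Carrier λ y → A a × B y × (x ≈ a ∙ y)

  ⁅ε⁆ : Subset G
  ⁅ε⁆ x = Lift c (x ≈ ε)

  ⊕-mono : ∀ {A A′ B B′} → A ⊆ A′ → B ⊆ B′ → A ⊕ B ⊆ A′ ⊕ B′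
  ⊕-mono A⊆A′ B⊆B′ x (a , y , a∈A , y∈B , x≈a∙y) = a , y , A⊆A′ a a∈A , B⊆B′ y y∈B , x≈a∙y

  translates-mono : ∀ X {S T} → S ⊆ T → translates G X S ⊆ translates G X T
  translates-mono X S⊆T x = Any.map λ (s , s∈S , x≈t∙s) → s , S⊆T s s∈S , x≈t∙s

  -- dilateShift G d A b is affineImage (mul G d) A b by definition.
  affineImage : (Carrier → Carrier) → Subset G → Carrier → Subset G
  affineImage φ A b x = Σ Carrier λ a → A a × (x ≈ φ a ∙ b)

  affineImage-mono : ∀ {φ A B} b → A ⊆ B → affineImage φ A b ⊆ affineImage φ B b
  affineImage-mono b A⊆B x (a , a∈A , x≈φa∙b) = a , A⊆B a a∈A , x≈φa∙b

  weightedSum : (q : ℕ) → (Fin q → ℕ) → (Fin q → Carrier) → Carrier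
  weightedSum zero    h b = ε
  weightedSum (suc q) h b = mul G (h fzero) (b fzero) ∙ weightedSum q (λ i → h (fsuc i)) (λ i → b (fsuc i))

  mul≡· : ∀ n x → mul G n x ≡ n · x
  mul≡· zero    x = ≡.refl
  mul≡· (suc n) x = ≡.cong (x ∙_) (mul≡· n x)

  mul-ε : ∀ n → mul G n ε ≈ ε
  mul-ε zero    = refl
  mul-ε (suc n) = trans (identityˡ _) (mul-ε n)

  mul-isMonoidHomomorphism : ∀ d → IsMonoidHomomorphism (mul G d)
  mul-isMonoidHomomorphism d = record
    { isMagmaHomomorphism = record
      { isRelHomomorphism = record { cong = mul-cong }
      ; homo = mul-homo
      }
    ; ε-homo = mul-ε d
    }
    where
    mul-cong : ∀ {x y} → x ≈ y → mul G d x ≈ mul G d y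
    mul-cong {x} {y} x≈y = begin
      mul G d x  ≡⟨ mul≡· d x ⟩
      d · x      ≈⟨ ×-congʳ d x≈y ⟩
      d · y      ≡⟨ mul≡· d y ⟨
      mul G d y  ∎

    mul-homo : ∀ x y → mul G d (x ∙ y) ≈ mul G d x ∙ mul G d y
    mul-homo x y = begin
      mul G d (x ∙ y)          ≡⟨ mul≡· d (x ∙ y) ⟩
      d · (x ∙ y)              ≈⟨ ×-distrib-+ x y d ⟩
      d · x ∙ d · y            ≡⟨ ≡.cong₂ _∙_ (mul≡· d x) (mul≡· d y) ⟨
      mul G d x ∙ mul G d y    ∎

  module _ {φ : Carrier → Carrier} (φ-hom : IsMonoidHomomorphism φ) where
    open IsMonoidHomomorphism φ-hom using (homo; ε-homo) renaming (⟦⟧-cong to φ-cong)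

    affineImage-⁅ε⁆⊆ : affineImage φ ⁅ε⁆ ε ⊆ ⁅ε⁆
    affineImage-⁅ε⁆⊆ x (a , lift a≈ε , x≈φa∙ε) = lift (begin
      x        ≈⟨ x≈φa∙ε ⟩
      φ a ∙ ε  ≈⟨ identityʳ (φ a) ⟩
      φ a      ≈⟨ φ-cong a≈ε ⟩
      φ ε      ≈⟨ ε-homo ⟩
      ε        ∎)

    affineImage-⁅ε⁆⊇ : ⁅ε⁆ ⊆ affineImage φ ⁅ε⁆ ε
    affineImage-⁅ε⁆⊇ x (lift x≈ε) = ε , lift refl , (begin
      x        ≈⟨ x≈ε ⟩
      ε        ≈⟨ ε-homo ⟨
      φ ε      ≈⟨ identityʳ (φ ε) ⟨
      φ ε ∙ ε  ∎)

    affine-∙ : ∀ a b u v → (φ a ∙ u) ∙ (φ b ∙ v) ≈ φ (a ∙ b) ∙ (u ∙ v)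
    affine-∙ a b u v = begin
      (φ a ∙ u) ∙ (φ b ∙ v)  ≈⟨ interchange (φ a) u (φ b) v ⟩
      (φ a ∙ φ b) ∙ (u ∙ v)  ≈⟨ ∙-congʳ (homo a b) ⟨
      φ (a ∙ b) ∙ (u ∙ v)    ∎

    ⊕-affineImage⊆ : ∀ {A B} u v → affineImage φ A u ⊕ affineImage φ B v ⊆ affineImage φ (A ⊕ B) (u ∙ v)
    ⊕-affineImage⊆ u v x (a′ , b′ , (a , a∈A , a′≈φa∙u) , (b , b∈B , b′≈φb∙v) , x≈a′∙b′) =
      a ∙ b , (a , b , a∈A , b∈B , refl) , (begin
        x                      ≈⟨ x≈a′∙b′ ⟩
        a′ ∙ b′                ≈⟨ ∙-cong a′≈φa∙u b′≈φb∙v ⟩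
        (φ a ∙ u) ∙ (φ b ∙ v)  ≈⟨ affine-∙ a b u v ⟩
        φ (a ∙ b) ∙ (u ∙ v)    ∎)

    ⊕-affineImage⊇ : ∀ {A B} u v → affineImage φ (A ⊕ B) (u ∙ v) ⊆ affineImage φ A u ⊕ affineImage φ B v
    ⊕-affineImage⊇ u v x (s , (a , b , a∈A , b∈B , s≈a∙b) , x≈φs∙uv) =
      φ a ∙ u , φ b ∙ v , (a , a∈A , refl) , (b , b∈B , refl) , (begin
        x                      ≈⟨ x≈φs∙uv ⟩
        φ s ∙ (u ∙ v)          ≈⟨ ∙-congʳ (φ-cong s≈a∙b) ⟩
        φ (a ∙ b) ∙ (u ∙ v)    ≈⟨ affine-∙ a b u v ⟨
        (φ a ∙ u) ∙ (φ b ∙ v)  ∎)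

    hFold-affineImage⊆ : ∀ n {A} b → hFold G n (affineImage φ A b) ⊆ affineImage φ (hFold G n A) (mul G n b)
    hFold-affineImage⊆ zero    b = affineImage-⁅ε⁆⊇
    hFold-affineImage⊆ (suc n) b =
      ⊆-trans (⊕-mono ⊆-refl (hFold-affineImage⊆ n b)) (⊕-affineImage⊆ b (mul G n b))

    hFold-affineImage⊇ : ∀ n {A} b → affineImage φ (hFold G n A) (mul G n b) ⊆ hFold G n (affineImage φ A b)
    hFold-affineImage⊇ zero    b = affineImage-⁅ε⁆⊆
    hFold-affineImage⊇ (suc n) b =
      ⊆-trans (⊕-affineImage⊇ b (mul G n b)) (⊕-mono ⊆-refl (hFold-affineImage⊇ n b))

    tupleSum-affineImage⊆ : ∀ q h {𝒜} b →
      tupleSum G q h (λ i → affineImage φ (𝒜 i) (b i)) ⊆ affineImage φ (tupleSum G q h 𝒜) (weightedSum q h b)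
    tupleSum-affineImage⊆ zero    h b = affineImage-⁅ε⁆⊇
    tupleSum-affineImage⊆ (suc q) h b = ⊆-trans
      (⊕-mono (hFold-affineImage⊆ (h fzero) (b fzero)) (tupleSum-affineImage⊆ q (λ i → h (fsuc i)) (λ i → b (fsuc i))))
      (⊕-affineImage⊆ _ _)

    tupleSum-affineImage⊇ : ∀ q h {𝒜} b →
      affineImage φ (tupleSum G q h 𝒜) (weightedSum q h b) ⊆ tupleSum G q h (λ i → affineImage φ (𝒜 i) (b i))
    tupleSum-affineImage⊇ zero    h b = affineImage-⁅ε⁆⊆
    tupleSum-affineImage⊇ (suc q) h b = ⊆-trans
      (⊕-affineImage⊇ _ _)
      (⊕-mono (hFold-affineImage⊇ (h fzero) (b fzero)) (tupleSum-affineImage⊇ q (λ i → h (fsuc i)) (λ i → b (fsuc i))))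

    translates-affineImage⊆ : ∀ X {T} u v →
      affineImage φ (translates G X T) u ⊆ translates G (map (λ t → φ t ∙ (u - v)) X) (affineImage φ T v)
    translates-affineImage⊆ X {T} u v x (s , s∈X+T , x≈φs∙u) = map⁺ (Any.map shift s∈X+T)
      where
      shift : ∀ {t} → Σ Carrier (λ s′ → T s′ × s ≈ t ∙ s′) →
              Σ Carrier λ y → affineImage φ T v y × (x ≈ (φ t ∙ (u - v)) ∙ y)
      shift {t} (s′ , s′∈T , s≈t∙s′) = φ s′ ∙ v , (s′ , s′∈T , refl) , (begin
        x                             ≈⟨ x≈φs∙u ⟩
        φ s ∙ u                       ≈⟨ ∙-cong (φ-cong s≈t∙s′) (sym (//-rightDividesˡ v u)) ⟩
        φ (t ∙ s′) ∙ ((u - v) ∙ v)    ≈⟨ ∙-congʳ (homo t s′) ⟩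
        (φ t ∙ φ s′) ∙ ((u - v) ∙ v)  ≈⟨ interchange (φ t) (φ s′) (u - v) v ⟩
        (φ t ∙ (u - v)) ∙ (φ s′ ∙ v)  ∎)

    affineImage-preservesCover : ∀ q h h′ X {𝒜} b →
      tupleSum G q h′ 𝒜 ⊆ translates G X (tupleSum G q h 𝒜) →
      tupleSum G q h′ (λ i → affineImage φ (𝒜 i) (b i)) ⊆
        translates G (map (λ t → φ t ∙ (weightedSum q h′ b - weightedSum q h b)) X)
                     (tupleSum G q h (λ i → affineImage φ (𝒜 i) (b i)))
    affineImage-preservesCover q h h′ X b h′𝒜⊆X+h𝒜 =
      ⊆-trans (tupleSum-affineImage⊆ q h′ b)
        (⊆-trans (affineImage-mono _ h′𝒜⊆X+h𝒜)
          (⊆-trans (translates-affineImage⊆ X _ _)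
            (translates-mono _ (tupleSum-affineImage⊇ q h b))))

    affineImage-preservesApproxGroup : ∀ q r l {𝒜} b →
      ChromaticAsymptoticApproxGroup G q r l 𝒜 →
      ChromaticAsymptoticApproxGroup G q r l (λ i → affineImage φ (𝒜 i) (b i))
    affineImage-preservesApproxGroup q r l b (h₀ , cover) = h₀ , λ h h₀≤h →
      let (X , |X|≤l , rh𝒜⊆X+h𝒜) = cover h h₀≤h
      in  map _ X
        , ≡.subst (_≤ l) (≡.sym (length-map _ X)) |X|≤l
        , affineImage-preservesCover q h (λ i → r * h i) X b rh𝒜⊆X+h𝒜

-- The proof does not use that r, l and d are nonzero.
proposition2p4 : ∀ {c ℓ : Level} (G : AbelianGroup c ℓ) (q r l d : ℕ) → .{{NonZero r}} → .{{NonZero l}} → .{{NonZero d}} →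
    (b : Fin q → AbelianGroup.Carrier G) (𝒜 : Fin q → Subset G) →
    ChromaticAsymptoticApproxGroup G q r l 𝒜 →
    ChromaticAsymptoticApproxGroup G q r l (λ i → dilateShift G d (𝒜 i) (b i))
proposition2p4 G q r l d b 𝒜 =
  affineImage-preservesApproxGroup G (mul-isMonoidHomomorphism G d) q r l b
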